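{- The inquisitive implication $\to$ is not definable in $\textsf{INQ}^-$: there is no formula $\varphi(a,b)\in\textsf{INQ}^-$ such that $\varphi(\eta,\theta)\equiv\eta\to\theta$ for all $\eta,\theta\in\textsf{INQ}^-$.
   Context: Inquisitive semantics: a model is $M=(W,V)$ with $V$ assigning to each world a set of propositional letters; formulas are supported by states $s\subseteq W$. Clauses: $s\models p$ iff $p\in V(w)$ for all $w\in s$; $s\models\bot$ iff $s=\emptyset$; $s\models\top$ always; $s\models\psi\land\chi$ iff both; $s\models\psi\vee\chi$ (here $\vee$ denotes the inquisitive/global disjunction) iff $s\models\psi$ or $s\models\chi$; $s\models\psi\to\chi$ iff every $t\subseteq s$ supporting $\psi$ supports $\chi$; $s\models\psi\otimes\chi$ iff $s=t_1\cup t_2$ with $t_1\models\psi$, $t_2\models\chi$; $s\models\neg\psi$ iff no $t\subseteq s$ supports $\psi$; $s\models ?\psi$ iff $s\models\psi$ or $s\models\neg\psi$. $\textsf{INQ}^-$ is the propositional language with connectives $\land$, inquisitive disjunction $\vee$, $\otimes$, $\bot$, $\top$, $\neg$, $?$ (no implication). Two formulas are equivalent ($\equiv$) if they are supported by the same states in every model. -}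

module Defs where

open import Level using (Lift; lift) renaming (zero to ℓ0; suc to lsuc)
open import Data.Nat using (ℕ)
open import Data.Fin using (Fin; zero; suc)
open import Data.Empty using (⊥)
open import Data.Unit using (⊤)
open import Data.Product using (Σ; _×_)
open import Data.Sum using (_⊎_)
open import Function.Bundles using (_⇔_)

data Form (A : Set) : Set where
  atom : A → Form A
  bot  : Form A
  top  : Form A
  _∧_  : Form A → Form A → Form A
  _∨_  : Form A → Form A → Form A
  _⇒_  : Form A → Form A → Form A
  _⊗_  : Form A → Form A → Form A
  ¬′_  : Form A → Form A
  ¿_   : Form A → Form A

data InqMinus {A : Set} : Form A → Set where
  atom : ∀ a → InqMinus (atom a)
  bot  : InqMinus bot
  top  : InqMinus top
  and  : ∀ {φ ψ} → InqMinus φ → InqMinus ψ → InqMinus (φ ∧ ψ)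
  or   : ∀ {φ ψ} → InqMinus φ → InqMinus ψ → InqMinus (φ ∨ ψ)
  tens : ∀ {φ ψ} → InqMinus φ → InqMinus ψ → InqMinus (φ ⊗ ψ)
  neg  : ∀ {φ} → InqMinus φ → InqMinus (¬′ φ)
  que  : ∀ {φ} → InqMinus φ → InqMinus (¿ φ)

record Model : Set₁ where
  field
    W : Set
    V : W → ℕ → Set

State : Set → Set₁
State W = W → Set

_⊆_ : {W : Set} → State W → State W → Set
s ⊆ t = ∀ w → s w → t w

IsUnion : {W : Set} → State W → State W → State W → Set
IsUnion s t₁ t₂ = ∀ w → (s w → t₁ w ⊎ t₂ w) × (t₁ w ⊎ t₂ w → s w)

_,_⊨_ : (M : Model) → State (Model.W M) → Form ℕ → Set₁
M , s ⊨ atom p  = Lift (lsuc ℓ0) (∀ w → s w → Model.V M w p)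
M , s ⊨ bot     = Lift (lsuc ℓ0) (∀ w → s w → ⊥)
M , s ⊨ top     = Lift (lsuc ℓ0) ⊤
M , s ⊨ (φ ∧ ψ) = (M , s ⊨ φ) × (M , s ⊨ ψ)
M , s ⊨ (φ ∨ ψ) = (M , s ⊨ φ) ⊎ (M , s ⊨ ψ)
M , s ⊨ (φ ⇒ ψ) = ∀ t → t ⊆ s → M , t ⊨ φ → M , t ⊨ ψ
M , s ⊨ (φ ⊗ ψ) = Σ (State (Model.W M)) λ t₁ → Σ (State (Model.W M)) λ t₂ →
                    Lift (lsuc ℓ0) (IsUnion s t₁ t₂) × (M , t₁ ⊨ φ) × (M , t₂ ⊨ ψ)
M , s ⊨ (¬′ φ)  = ∀ t → t ⊆ s → M , t ⊨ φ → Lift (lsuc ℓ0) (∀ w → t w → ⊥)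
M , s ⊨ (¿ φ)   = (M , s ⊨ φ) ⊎
                  (∀ t → t ⊆ s → M , t ⊨ φ → Lift (lsuc ℓ0) (∀ w → t w → ⊥))

_≡ᵢ_ : Form ℕ → Form ℕ → Set₁
φ ≡ᵢ ψ = (M : Model) (s : State (Model.W M)) → (M , s ⊨ φ) ⇔ (M , s ⊨ ψ)

subst : {A B : Set} → Form A → (A → Form B) → Form B
subst (atom a) σ = σ a
subst bot σ = bot
subst top σ = top
subst (φ ∧ ψ) σ = subst φ σ ∧ subst ψ σ
subst (φ ∨ ψ) σ = subst φ σ ∨ subst ψ σ
subst (φ ⇒ ψ) σ = subst φ σ ⇒ subst ψ σ
subst (φ ⊗ ψ) σ = subst φ σ ⊗ subst ψ σ
subst (¬′ φ) σ = ¬′ subst φ σ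
subst (¿ φ) σ = ¿ subst φ σ

-- φ(η, θ): replace the two letters a = zero, b = suc zero of φ by η and θ.
inst : Form (Fin 2) → Form ℕ → Form ℕ → Form ℕ
inst φ η θ = subst φ σ
  where
  σ : Fin 2 → Form ℕ
  σ zero = η
  σ (suc zero) = θ

-- Take η = p₀ ∨ p₁ and θ = p₀ ∨ p₂ in the model with worlds w₀₁, w₀, w₁₂ (the index
-- lists the true letters).  There θ entails η, every singleton supports θ, and every state
-- splits into two θ-states.  Hence every INQ⁻ formula in η and θ is equivalent in this
-- model to a member of the chain ⊥ ≤ θ ≤ η ≤ ⊤: the chain is closed under ∧ (min), ∨ (max),
-- ⊗ (the other argument if one is ⊥, else ⊤) and ¬ (swaps ⊥ and ⊤, sends θ and η to ⊥).
-- But η → θ is supported by {w₀, w₁₂}, which supports no member of the chain except ⊤,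
-- and not by {w₀₁, w₁₂}, which does support ⊤.
module Submission where

open import Defs
open import Data.Nat using (ℕ)
open import Data.Fin using (Fin)
open import Data.Product using (Σ; _×_)
open import Relation.Nullary using (¬_)

open import Level using (lift; lower)
open import Data.Nat using (zero; suc; _≤_; z≤n; s≤s; _⊔_; _⊓_)
open import Data.Nat.Properties using (≤-reflexive; m≤m⊔n; m≤n⊔m; ⊔-sel; m⊓n≤m; m⊓n≤n; ⊓-sel)
open import Data.Fin using (zero; suc)
open import Data.Empty using (⊥; ⊥-elim)
open import Data.Unit using (⊤; tt)
open import Data.Product using (_,_; proj₁; proj₂)
open import Data.Sum using (inj₁; inj₂; [_,_]′)
import Data.Product as Product
import Data.Sum as Sum
open import Function using (id; _∘_)
open import Function.Bundles using (_⇔_; mk⇔; Equivalence)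
open import Function.Construct.Composition using (_⇔-∘_)
open import Function.Construct.Symmetry using (⇔-sym)
open import Relation.Binary.PropositionalEquality using (_≡_; refl; sym)

open Equivalence using (to; from)

module Support (M : Model) where

  open Model M

  IsEmpty : State W → Set
  IsEmpty s = ∀ w → s w → ⊥

  ⊨-empty : ∀ φ {s} → IsEmpty s → M , s ⊨ φ
  ⊨-empty (atom p) e = lift λ w x → ⊥-elim (e w x)
  ⊨-empty bot      e = lift e
  ⊨-empty top      e = lift tt
  ⊨-empty (φ ∧ ψ)  e = ⊨-empty φ e , ⊨-empty ψ e
  ⊨-empty (φ ∨ ψ)  e = inj₁ (⊨-empty φ e)
  ⊨-empty (φ ⇒ ψ)  e = λ t t⊆s _ → ⊨-empty ψ λ w x → e w (t⊆s w x)
  ⊨-empty (φ ⊗ ψ) {s} e =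
    s , s , lift (λ w → inj₁ , [ id , id ]′) , ⊨-empty φ e , ⊨-empty ψ e
  ⊨-empty (¬′ φ)   e = λ t t⊆s _ → lift λ w x → e w (t⊆s w x)
  ⊨-empty (¿ φ)    e = inj₁ (⊨-empty φ e)

  ⊨-persistent : ∀ φ {s t} → t ⊆ s → M , s ⊨ φ → M , t ⊨ φ
  ⊨-persistent (atom p) t⊆s (lift h) = lift λ w x → h w (t⊆s w x)
  ⊨-persistent bot      t⊆s (lift h) = lift λ w x → h w (t⊆s w x)
  ⊨-persistent top      t⊆s h        = h
  ⊨-persistent (φ ∧ ψ)  t⊆s (h , k)  = ⊨-persistent φ t⊆s h , ⊨-persistent ψ t⊆s k
  ⊨-persistent (φ ∨ ψ)  t⊆s h        =
    Sum.map (⊨-persistent φ t⊆s) (⊨-persistent ψ t⊆s) h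
  ⊨-persistent (φ ⇒ ψ)  t⊆s h        = λ u u⊆t → h u λ w x → t⊆s w (u⊆t w x)
  ⊨-persistent (φ ⊗ ψ) {t = t} t⊆s (t₁ , t₂ , lift s≡t₁∪t₂ , h₁ , h₂) =
    (λ w → t w × t₁ w) , (λ w → t w × t₂ w) , lift t≡∪ ,
    ⊨-persistent φ (λ _ → proj₂) h₁ , ⊨-persistent ψ (λ _ → proj₂) h₂
    where
    t≡∪ : IsUnion t (λ w → t w × t₁ w) (λ w → t w × t₂ w)
    t≡∪ w = (λ x → Sum.map (x ,_) (x ,_) (proj₁ (s≡t₁∪t₂ w) (t⊆s w x)))
          , [ proj₁ , proj₁ ]′
  ⊨-persistent (¬′ φ)   t⊆s h        = λ u u⊆t → h u λ w x → t⊆s w (u⊆t w x)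
  ⊨-persistent (¿ φ)    t⊆s h        =
    Sum.map (⊨-persistent φ t⊆s) (λ k u u⊆t → k u λ w x → t⊆s w (u⊆t w x)) h

  infix 4 _≈_

  record _≈_ (φ ψ : Form ℕ) : Set₁ where
    constructor mk≈
    field support⇔ : ∀ s → (M , s ⊨ φ) ⇔ (M , s ⊨ ψ)

  open _≈_ public

  ≈-refl : ∀ {φ} → φ ≈ φ
  ≈-refl = mk≈ λ s → mk⇔ id id

  ≈-sym : ∀ {φ ψ} → φ ≈ ψ → ψ ≈ φ
  ≈-sym e = mk≈ λ s → ⇔-sym (support⇔ e s)

  ≈-trans : ∀ {φ ψ χ} → φ ≈ ψ → ψ ≈ χ → φ ≈ χ
  ≈-trans e f = mk≈ λ s → support⇔ f s ⇔-∘ support⇔ e s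

  ∧-cong : ∀ {φ φ′ ψ ψ′} → φ ≈ φ′ → ψ ≈ ψ′ → φ ∧ ψ ≈ φ′ ∧ ψ′
  ∧-cong (mk≈ e) (mk≈ f) = mk≈ λ s →
    mk⇔ (Product.map (to (e s)) (to (f s))) (Product.map (from (e s)) (from (f s)))

  ∨-cong : ∀ {φ φ′ ψ ψ′} → φ ≈ φ′ → ψ ≈ ψ′ → φ ∨ ψ ≈ φ′ ∨ ψ′
  ∨-cong (mk≈ e) (mk≈ f) = mk≈ λ s →
    mk⇔ (Sum.map (to (e s)) (to (f s))) (Sum.map (from (e s)) (from (f s)))

  ⊗-cong : ∀ {φ φ′ ψ ψ′} → φ ≈ φ′ → ψ ≈ ψ′ → φ ⊗ ψ ≈ φ′ ⊗ ψ′
  ⊗-cong (mk≈ e) (mk≈ f) = mk≈ λ s → mk⇔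
    (λ (t₁ , t₂ , u , h₁ , h₂) → t₁ , t₂ , u , to (e t₁) h₁ , to (f t₂) h₂)
    (λ (t₁ , t₂ , u , h₁ , h₂) → t₁ , t₂ , u , from (e t₁) h₁ , from (f t₂) h₂)

  ¬-cong : ∀ {φ φ′} → φ ≈ φ′ → ¬′ φ ≈ ¬′ φ′
  ¬-cong (mk≈ e) = mk≈ λ s →
    mk⇔ (λ h t t⊆s k → h t t⊆s (from (e t) k)) (λ h t t⊆s k → h t t⊆s (to (e t) k))

  ¿≈∨¬ : ∀ {φ} → ¿ φ ≈ φ ∨ (¬′ φ)
  ¿≈∨¬ = mk≈ λ s → mk⇔ id id

  ⊗-identityˡ : ∀ φ → bot ⊗ φ ≈ φ
  ⊗-identityˡ φ = mk≈ λ s → mk⇔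
    (λ (t₁ , t₂ , lift s≡t₁∪t₂ , lift t₁-empty , h) →
      ⊨-persistent φ (λ w x → [ ⊥-elim ∘ t₁-empty w , id ]′ (proj₁ (s≡t₁∪t₂ w) x)) h)
    (λ h → (λ _ → ⊥) , s , lift (λ w → inj₂ , [ ⊥-elim , id ]′) , lift (λ _ ()) , h)

  ⊗-identityʳ : ∀ φ → φ ⊗ bot ≈ φ
  ⊗-identityʳ φ = mk≈ λ s → mk⇔
    (λ (t₁ , t₂ , lift s≡t₁∪t₂ , h , lift t₂-empty) →
      ⊨-persistent φ (λ w x → [ id , ⊥-elim ∘ t₂-empty w ]′ (proj₁ (s≡t₁∪t₂ w) x)) h)
    (λ h → s , (λ _ → ⊥) , lift (λ w → inj₁ , [ id , ⊥-elim ]′) , h , lift (λ _ ()))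

  ¬bot≈top : ¬′ bot ≈ top
  ¬bot≈top = mk≈ λ s → mk⇔ (λ _ → lift tt) (λ _ _ _ → id)

  singleton : W → State W
  singleton w v = v ≡ w

  ¬≈bot : ∀ {φ} → (∀ w → M , singleton w ⊨ φ) → ¬′ φ ≈ bot
  ¬≈bot everywhere = mk≈ λ s → mk⇔
    (λ h → lift λ w x → lower (h (singleton w) (λ { _ refl → x }) (everywhere w)) w refl)
    (λ (lift s-empty) t t⊆s _ → lift λ w x → s-empty w (t⊆s w x))

data World : Set where
  w₀₁ w₀ w₁₂ : World

Val : World → ℕ → Set
Val w₀₁ 0 = ⊤
Val w₀₁ 1 = ⊤
Val w₀  0 = ⊤
Val w₁₂ 1 = ⊤
Val w₁₂ 2 = ⊤
Val _   _ = ⊥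

M : Model
M = record { W = World ; V = Val }

open Support M

η θ : Form ℕ
η = atom 0 ∨ atom 1
θ = atom 0 ∨ atom 2

θ⊨η : ∀ {s} → M , s ⊨ θ → M , s ⊨ η
θ⊨η (inj₁ p₀) = inj₁ p₀
θ⊨η {s} (inj₂ (lift p₂)) = inj₂ (lift p₁)
  where
  p₁ : ∀ w → s w → Val w 1
  p₁ w₀₁ _ = tt
  p₁ w₀  x = p₂ w₀ x
  p₁ w₁₂ _ = tt

singleton⊨θ : ∀ w → M , singleton w ⊨ θ
singleton⊨θ w₀₁ = inj₁ (lift λ { _ refl → tt })
singleton⊨θ w₀  = inj₁ (lift λ { _ refl → tt })
singleton⊨θ w₁₂ = inj₂ (lift λ { _ refl → tt })

θ-split : ∀ s → Σ (State World) λ t₁ → Σ (State World) λ t₂ →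
          IsUnion s t₁ t₂ × M , t₁ ⊨ θ × M , t₂ ⊨ θ
θ-split s = (λ w → s w × Val w 0) , (λ w → s w × Val w 2) , s≡∪ ,
            inj₁ (lift λ _ → proj₂) , inj₂ (lift λ _ → proj₂)
  where
  s≡∪ : IsUnion s (λ w → s w × Val w 0) (λ w → s w × Val w 2)
  s≡∪ w₀₁ = (λ x → inj₁ (x , tt)) , [ proj₁ , proj₁ ]′
  s≡∪ w₀  = (λ x → inj₁ (x , tt)) , [ proj₁ , proj₁ ]′
  s≡∪ w₁₂ = (λ x → inj₂ (x , tt)) , [ proj₁ , proj₁ ]′

-- Indexing the chain by ℕ (all n ≥ 3 meaning ⊤) turns ∨ and ∧ into ⊔ and ⊓ on ℕ.
level : ℕ → Form ℕ
level 0 = bot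
level 1 = θ
level 2 = η
level (suc (suc (suc _))) = top

level-mono : ∀ {m n} → m ≤ n → ∀ {s} → M , s ⊨ level m → M , s ⊨ level n
level-mono {zero} {n} _ (lift e) = ⊨-empty (level n) e
level-mono {1} {1} _ h = h
level-mono {1} {2} _ h = θ⊨η h
level-mono {1} {suc (suc (suc _))} _ _ = lift tt
level-mono {2} {2} _ h = h
level-mono {2} {suc (suc (suc _))} _ _ = lift tt
level-mono {suc (suc (suc _))} {suc (suc (suc _))} _ _ = lift tt
level-mono {1} {zero} ()
level-mono {2} {zero} ()
level-mono {2} {1} (s≤s ())
level-mono {suc (suc (suc _))} {zero} ()
level-mono {suc (suc (suc _))} {1} (s≤s ())
level-mono {suc (suc (suc _))} {2} (s≤s (s≤s ()))

∨-level : ∀ i j → level i ∨ level j ≈ level (i ⊔ j)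
∨-level i j = mk≈ λ s → mk⇔
  [ level-mono (m≤m⊔n i j) , level-mono (m≤n⊔m i j) ]′
  (λ h → Sum.map (λ e → level-mono (≤-reflexive e) h) (λ e → level-mono (≤-reflexive e) h)
                 (⊔-sel i j))

∧-level : ∀ i j → level i ∧ level j ≈ level (i ⊓ j)
∧-level i j = mk≈ λ s → mk⇔
  (λ (h , k) → [ (λ e → level-mono (≤-reflexive (sym e)) h)
               , (λ e → level-mono (≤-reflexive (sym e)) k) ]′ (⊓-sel i j))
  (λ h → level-mono (m⊓n≤m i j) h , level-mono (m⊓n≤n i j) h)

_⊗ℓ_ : ℕ → ℕ → ℕ
zero  ⊗ℓ j     = j
suc i ⊗ℓ zero  = suc i
suc i ⊗ℓ suc j = 3

⊗-level : ∀ i j → level i ⊗ level j ≈ level (i ⊗ℓ j)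
⊗-level zero    j       = ⊗-identityˡ (level j)
⊗-level (suc i) zero    = ⊗-identityʳ (level (suc i))
⊗-level (suc i) (suc j) = mk≈ λ s → mk⇔ (λ _ → lift tt) λ _ →
  let (t₁ , t₂ , s≡t₁∪t₂ , h₁ , h₂) = θ-split s
  in t₁ , t₂ , lift s≡t₁∪t₂ , level-mono {1} (s≤s z≤n) h₁ , level-mono {1} (s≤s z≤n) h₂

¬ℓ : ℕ → ℕ
¬ℓ zero    = 3
¬ℓ (suc _) = 0

¬-level : ∀ i → ¬′ level i ≈ level (¬ℓ i)
¬-level zero    = ¬bot≈top
¬-level (suc i) = ¬≈bot λ w → level-mono {1} (s≤s z≤n) (singleton⊨θ w)

inst-level : ∀ {φ} → InqMinus φ → Σ ℕ λ n → inst φ η θ ≈ level n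
inst-level (atom zero)       = 2 , ≈-refl
inst-level (atom (suc zero)) = 1 , ≈-refl
inst-level bot               = 0 , ≈-refl
inst-level top               = 3 , ≈-refl
inst-level (and a b) with inst-level a | inst-level b
... | i , e | j , f = i ⊓ j , ≈-trans (∧-cong e f) (∧-level i j)
inst-level (or a b) with inst-level a | inst-level b
... | i , e | j , f = i ⊔ j , ≈-trans (∨-cong e f) (∨-level i j)
inst-level (tens a b) with inst-level a | inst-level b
... | i , e | j , f = i ⊗ℓ j , ≈-trans (⊗-cong e f) (⊗-level i j)
inst-level (neg a) with inst-level a
... | i , e = ¬ℓ i , ≈-trans (¬-cong e) (¬-level i)
inst-level (que a) with inst-level a
... | i , e = i ⊔ ¬ℓ i ,
  ≈-trans ¿≈∨¬ (≈-trans (∨-cong e (≈-trans (¬-cong e) (¬-level i))) (∨-level i (¬ℓ i)))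

s⁺ s⁻ : State World
s⁺ w₀₁ = ⊥
s⁺ _   = ⊤
s⁻ w₀  = ⊥
s⁻ _   = ⊤

s⁺⊨η⇒θ : M , s⁺ ⊨ (η ⇒ θ)
s⁺⊨η⇒θ _ _ (inj₁ p₀) = inj₁ p₀
s⁺⊨η⇒θ t t⊆s⁺ (inj₂ (lift p₁)) = inj₂ (lift p₂)
  where
  p₂ : ∀ w → t w → Val w 2
  p₂ w₀₁ x = t⊆s⁺ w₀₁ x
  p₂ w₀  x = p₁ w₀ x
  p₂ w₁₂ _ = tt

s⁻⊭η⇒θ : ¬ (M , s⁻ ⊨ (η ⇒ θ))
s⁻⊭η⇒θ h with h s⁻ (λ _ → id) (inj₂ (lift λ { w₀₁ _ → tt ; w₁₂ _ → tt }))
... | inj₁ (lift p₀) = p₀ w₁₂ tt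
... | inj₂ (lift p₂) = p₂ w₀₁ tt

s⁺⊨level⇒s⁻⊨level : ∀ n → M , s⁺ ⊨ level n → M , s⁻ ⊨ level n
s⁺⊨level⇒s⁻⊨level 0 (lift e) = ⊥-elim (e w₀ tt)
s⁺⊨level⇒s⁻⊨level 1 (inj₁ (lift p₀)) = ⊥-elim (p₀ w₁₂ tt)
s⁺⊨level⇒s⁻⊨level 1 (inj₂ (lift p₂)) = ⊥-elim (p₂ w₀ tt)
s⁺⊨level⇒s⁻⊨level 2 (inj₁ (lift p₀)) = ⊥-elim (p₀ w₁₂ tt)
s⁺⊨level⇒s⁻⊨level 2 (inj₂ (lift p₁)) = ⊥-elim (p₁ w₀ tt)
s⁺⊨level⇒s⁻⊨level (suc (suc (suc _))) _ = lift tt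

level≉η⇒θ : ∀ n → ¬ (level n ≈ η ⇒ θ)
level≉η⇒θ n (mk≈ e) = s⁻⊭η⇒θ (to (e s⁻) (s⁺⊨level⇒s⁻⊨level n (from (e s⁺) s⁺⊨η⇒θ)))

theorem3p3 : ¬ (Σ (Form (Fin 2)) λ φ → InqMinus φ ×
                ((η θ : Form ℕ) → InqMinus η → InqMinus θ → inst φ η θ ≡ᵢ (η ⇒ θ)))
theorem3p3 (φ , φ∈INQ⁻ , φ-defines⇒) =
  let (n , e) = inst-level φ∈INQ⁻
  in level≉η⇒θ n (≈-trans (≈-sym e)
       (mk≈ (φ-defines⇒ η θ (or (atom 0) (atom 1)) (or (atom 0) (atom 2)) M)))
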